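{- Let $p\geq 2$ be prime, let $n\geq 1$, let $\mathcal B=\mathcal I_1\times\cdots\times\mathcal I_n$ with each $\mathcal I_j\subseteq\mathbb Z$ ($j\in[1,n]$) a complete system of residues modulo $p$, and suppose $f\in\mathbb Q[X_1,\ldots,X_n]$ is an integer valued polynomial such that $\deg_j f\leq p-2$ for every $j\in[1,n]$ and $\mathsf v_p(c)\geq 0$ for every coefficient $c\in\mathbb Q$ of a monomial occurring in $f$. Then $$\sum_{\mathbf a\in\mathcal B}f(\mathbf a)\equiv 0\pmod{p^n}.$$
   Context: A complete system of residues modulo $p$ is a set $\mathcal I\subseteq\mathbb Z$ with $|\mathcal I|=p$ whose elements are pairwise distinct modulo $p$. $f\in\mathbb Q[X_1,\ldots,X_n]$ is integer valued if $f(\mathbf a)\in\mathbb Z$ for all $\mathbf a\in\mathbb Z^n$. $\deg_j f$ is the degree of $f$ in the variable $X_j$. $\mathsf v_p$ is the $p$-adic valuation on $\mathbb Q$. The convention $0^0=1$ is used. -}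

module Defs where

open import Data.Nat as ℕ using (ℕ; zero; suc)
open import Data.Nat.Divisibility as ℕD using ()
open import Data.Fin using (Fin; zero; suc; toℕ)
open import Data.Vec.Functional using (_∷_)
open import Data.Integer as ℤ using (ℤ)
open import Data.Integer.Divisibility as ℤD using ()
open import Data.Rational using (ℚ; _+_; _*_; 0ℚ; 1ℚ; _/_)
open import Data.Product using (∃)
open import Relation.Binary.PropositionalEquality using (_≡_)
open import Relation.Nullary using (¬_)

ℤ→ℚ : ℤ → ℚ
ℤ→ℚ z = z / 1

_^ℚ_ : ℚ → ℕ → ℚ
x ^ℚ zero  = 1ℚ
x ^ℚ suc k = x * (x ^ℚ k)

sumFin : (m : ℕ) → (Fin m → ℚ) → ℚ
sumFin zero    g = 0ℚ
sumFin (suc m) g = g zero + sumFin m (λ i → g (suc i))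

prodFin : (m : ℕ) → (Fin m → ℚ) → ℚ
prodFin zero    g = 1ℚ
prodFin (suc m) g = g zero * prodFin m (λ i → g (suc i))

sumTuples : (n m : ℕ) → ((Fin n → Fin m) → ℚ) → ℚ
sumTuples zero    m F = F (λ ())
sumTuples (suc n) m F = sumFin m (λ i → sumTuples n m (λ t → F (i ∷ t)))

-- A polynomial in ℚ[X_1,…,X_n], given by its coefficients on all
-- monomials X^e with every exponent e_j ≤ D (D arbitrary).
record Poly (n : ℕ) : Set where
  field
    D    : ℕ
    coef : (Fin n → Fin (suc D)) → ℚ
open Poly public

eval : {n : ℕ} → Poly n → (Fin n → ℤ) → ℚ
eval {n} f a =
  sumTuples n (suc (D f)) (λ e → coef f e * prodFin n (λ j → ℤ→ℚ (a j) ^ℚ toℕ (e j)))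

degLe : {n : ℕ} → Poly n → Fin n → ℕ → Set
degLe f j d = ∀ e → ¬ (coef f e ≡ 0ℚ) → toℕ (e j) ℕ.≤ d

vpNonneg : ℕ → ℚ → Set
vpNonneg p c = ¬ (p ℕD.∣ ℚ.denominatorℕ c)

IntegerValued : {n : ℕ} → Poly n → Set
IntegerValued {n} f = ∀ (a : Fin n → ℤ) → ∃ λ (z : ℤ) → eval f a ≡ ℤ→ℚ z

CompleteResidues : (p : ℕ) → (Fin p → ℤ) → Set
CompleteResidues p I = ∀ s t → (ℤ.+ p) ℤD.∣ (I s ℤ.- I t) → s ≡ t

module Submission where

-- Expanding f into monomials, Σ_{a ∈ B} f(a) = Σ_e c_e Π_j Σ_{x ∈ I_j} x^{e_j}.  Each inner sum is, modulo
-- p, the power sum S_k = Σ_{s < p} s^k with k = e_j ≤ p − 2, because x ↦ x mod p maps I_j bijectively onto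
-- [0, p).  Telescoping (s + 1)^{k+1} − s^{k+1} over s < p and expanding binomially gives
-- Σ_{i ≤ k} C(k+1, i) S_i = p^{k+1}, so by induction on k, p ∣ (k + 1) S_k and hence p ∣ S_k as k + 1 < p.
-- Every monomial sum is thus p-integral times a product of n multiples of p, i.e. has p-adic valuation at
-- least n, and so does the whole sum, which is an integer because f is integer valued.

open import Defs

module IntegerPowerSums where

  import Data.Integer.Properties as ℤₚ
  open import Algebra.Properties.CommutativeSemiring.Binomial ℤₚ.+-*-commutativeSemiring
    using (binomialTerm) renaming (theorem to binomial-theorem)
  open import Algebra.Properties.Semiring.Exp ℤₚ.+-*-semiring using () renaming (_^_ to _^′_)
  open import Algebra.Properties.Semiring.Mult ℤₚ.+-*-semiring using (_×_)
  open import Algebra.Properties.Semiring.Sum ℤₚ.+-*-semiring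
    using (sum; sum-syntax; sum-cong-≗; ∑-comm; ∑-distrib-+; ∑-permute; *-distribˡ-sum; sum-init-last)
  open import Data.Empty using (⊥-elim)
  open import Data.Fin as Fin using (Fin; zero; suc; toℕ; fromℕ; inject₁; punchOut)
  import Data.Fin.Properties as Finₚ
  open import Data.Fin.Permutation using (Permutation′; permutation)
  open import Data.Integer using (ℤ; +_; _+_; _-_; _*_; _^_; 0ℤ; 1ℤ)
  open import Data.Integer.Coprimality using (coprime-divisor)
  open import Data.Integer.Divisibility.Signed as ℤ∣ using (_∣_; divides)
  open import Data.Integer.DivMod using (_%ℕ_; _/ℕ_; n%ℕd<d; a≡a%ℕn+[a/ℕn]*n)
  open import Data.Integer.Tactic.RingSolver using (solve-∀)
  open import Data.Nat as ℕ using (ℕ; zero; suc)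
  open import Data.Nat.Combinatorics using (_C_; nCn≡1; nC1≡n; nCk≡nC[n∸k])
  open import Data.Nat.Coprimality using (prime⇒coprime)
  open import Data.Nat.Induction using (<-rec)
  open import Data.Nat.Primality using (Prime; prime⇒nonZero)
  import Data.Nat.Properties as ℕₚ
  open import Data.Product using (_,_; proj₁; proj₂)
  open import Function using (_∘_)
  open import Function.Definitions using (Injective; Surjective)
  open import Relation.Binary.PropositionalEquality
  open import Relation.Nullary using (yes; no)

  open ≡-Reasoning

  n×x≡+n*x : ∀ n x → n × x ≡ + n * x
  n×x≡+n*x zero    x = sym (ℤₚ.*-zeroˡ x)
  n×x≡+n*x (suc n) x = begin
    x + n × x         ≡⟨ cong (λ y → x + y) (n×x≡+n*x n x) ⟩
    x + + n * x       ≡⟨ cong (_+ + n * x) (ℤₚ.*-identityˡ x) ⟨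
    1ℤ * x + + n * x  ≡⟨ ℤₚ.*-distribʳ-+ x 1ℤ (+ n) ⟨
    + suc n * x       ∎

  ^′≡^ : ∀ x n → x ^′ n ≡ x ^ n
  ^′≡^ x zero    = refl
  ^′≡^ x (suc n) = cong (x *_) (^′≡^ x n)

  ∑-telescope : ∀ m (h : ℕ → ℤ) → ∑[ i < m ] (h (suc (toℕ i)) - h (toℕ i)) ≡ h m - h 0
  ∑-telescope zero    h = sym (ℤₚ.+-inverseʳ (h 0))
  ∑-telescope (suc m) h = begin
    (h 1 - h 0) + ∑[ i < m ] (h (2 ℕ.+ toℕ i) - h (suc (toℕ i)))
      ≡⟨ cong (λ y → (h 1 - h 0) + y) (∑-telescope m (h ∘ suc)) ⟩
    (h 1 - h 0) + (h (suc m) - h 1)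
      ≡⟨ cancel (h 0) (h 1) (h (suc m)) ⟩
    h (suc m) - h 0 ∎
    where
    cancel : ∀ a b c → (b - a) + (c - b) ≡ c - a
    cancel = solve-∀

  binomialTerm[x,1] : ∀ x n (i : Fin (suc n)) → binomialTerm x 1ℤ n i ≡ + (n C toℕ i) * x ^ toℕ i
  binomialTerm[x,1] x n i = begin
    (n C toℕ i) × (x ^′ toℕ i * 1ℤ ^′ (n ℕ.∸ toℕ i))
      ≡⟨ n×x≡+n*x (n C toℕ i) _ ⟩
    + (n C toℕ i) * (x ^′ toℕ i * 1ℤ ^′ (n ℕ.∸ toℕ i))
      ≡⟨ cong (λ y → + (n C toℕ i) * (x ^′ toℕ i * y)) (trans (^′≡^ 1ℤ n-i) (ℤₚ.^-zeroˡ n-i)) ⟩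
    + (n C toℕ i) * (x ^′ toℕ i * 1ℤ)
      ≡⟨ cong (+ (n C toℕ i) *_) (trans (ℤₚ.*-identityʳ _) (^′≡^ x (toℕ i))) ⟩
    + (n C toℕ i) * x ^ toℕ i ∎
    where
    n-i : ℕ
    n-i = n ℕ.∸ toℕ i

  [x+1]^[1+k]-x^[1+k] : ∀ x k →
    (x + 1ℤ) ^ suc k - x ^ suc k ≡ ∑[ i < suc k ] (+ (suc k C toℕ i) * x ^ toℕ i)
  [x+1]^[1+k]-x^[1+k] x k = begin
    (x + 1ℤ) ^ suc k - x ^ suc k     ≡⟨ cong (_- x ^ suc k) expand ⟩
    (lower + x ^ suc k) - x ^ suc k  ≡⟨ cancel lower (x ^ suc k) ⟩
    lower                            ∎
    where
    lower : ℤ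
    lower = ∑[ i < suc k ] (+ (suc k C toℕ i) * x ^ toℕ i)
    cancel : ∀ a b → (a + b) - b ≡ a
    cancel = solve-∀
    term : Fin (2 ℕ.+ k) → ℤ
    term = binomialTerm x 1ℤ (suc k)
    top : term (fromℕ (suc k)) ≡ x ^ suc k
    top = begin
      term (fromℕ (suc k))
        ≡⟨ binomialTerm[x,1] x (suc k) (fromℕ (suc k)) ⟩
      + (suc k C toℕ (fromℕ (suc k))) * x ^ toℕ (fromℕ (suc k))
        ≡⟨ cong (λ j → + (suc k C j) * x ^ j) (Finₚ.toℕ-fromℕ (suc k)) ⟩
      + (suc k C suc k) * x ^ suc k
        ≡⟨ cong (λ c → + c * x ^ suc k) (nCn≡1 (suc k)) ⟩
      1ℤ * x ^ suc k
        ≡⟨ ℤₚ.*-identityˡ _ ⟩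
      x ^ suc k ∎
    expand : (x + 1ℤ) ^ suc k ≡ lower + x ^ suc k
    expand = begin
      (x + 1ℤ) ^ suc k                               ≡⟨ ^′≡^ (x + 1ℤ) (suc k) ⟨
      (x + 1ℤ) ^′ suc k                              ≡⟨ binomial-theorem (suc k) x 1ℤ ⟩
      sum term                                       ≡⟨ sum-init-last term ⟩
      sum (term ∘ inject₁) + term (fromℕ (suc k))    ≡⟨ cong₂ _+_ (sum-cong-≗ lowerTerm) top ⟩
      lower + x ^ suc k                              ∎
      where
      lowerTerm : ∀ i → term (inject₁ i) ≡ + (suc k C toℕ i) * x ^ toℕ i
      lowerTerm i = trans (binomialTerm[x,1] x (suc k) (inject₁ i))
        (cong (λ j → + (suc k C j) * x ^ j) (Finₚ.toℕ-inject₁ i))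

  powerSum : ℕ → ℕ → ℤ
  powerSum m k = ∑[ s < m ] ((+ toℕ s) ^ k)

  ∑-binomial-powerSum : ∀ m k → ∑[ i < suc k ] (+ (suc k C toℕ i) * powerSum m (toℕ i)) ≡ (+ m) ^ suc k
  ∑-binomial-powerSum m k = begin
    ∑[ i < suc k ] (c i * ∑[ s < m ] ((+ toℕ s) ^ toℕ i))
      ≡⟨ sum-cong-≗ {suc k} (λ i → *-distribˡ-sum {m} (c i) (λ s → (+ toℕ s) ^ toℕ i)) ⟩
    ∑[ i < suc k ] ∑[ s < m ] (c i * (+ toℕ s) ^ toℕ i)
      ≡⟨ ∑-comm {suc k} {m} (λ i s → c i * (+ toℕ s) ^ toℕ i) ⟩
    ∑[ s < m ] ∑[ i < suc k ] (c i * (+ toℕ s) ^ toℕ i)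
      ≡⟨ sum-cong-≗ {m} (λ s → sym (step (toℕ s))) ⟩
    ∑[ s < m ] ((+ suc (toℕ s)) ^ suc k - (+ toℕ s) ^ suc k)
      ≡⟨ ∑-telescope m (λ n → (+ n) ^ suc k) ⟩
    (+ m) ^ suc k - 0ℤ
      ≡⟨ ℤₚ.+-identityʳ _ ⟩
    (+ m) ^ suc k ∎
    where
    c : Fin (suc k) → ℤ
    c i = + (suc k C toℕ i)
    step : ∀ n → (+ suc n) ^ suc k - (+ n) ^ suc k ≡ ∑[ i < suc k ] (c i * (+ n) ^ toℕ i)
    step n = trans (cong (λ y → y ^ suc k - (+ n) ^ suc k) (ℤₚ.+-comm 1ℤ (+ n))) ([x+1]^[1+k]-x^[1+k] (+ n) k)

  ∣-∑ : ∀ {d n} (f : Fin n → ℤ) → (∀ i → d ∣ f i) → d ∣ sum f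
  ∣-∑ {n = zero}  f d∣f = divides 0ℤ refl
  ∣-∑ {n = suc n} f d∣f = ℤ∣.∣m∣n⇒∣m+n (d∣f zero) (∣-∑ (f ∘ suc) (d∣f ∘ suc))

  p∣powerSum : ∀ {p} → Prime p → ∀ k → suc k ℕ.< p → + p ∣ powerSum p k
  p∣powerSum {p} pr = <-rec (λ k → suc k ℕ.< p → + p ∣ powerSum p k) step
    where
    step : ∀ k → (∀ {i} → i ℕ.< k → suc i ℕ.< p → + p ∣ powerSum p i) → suc k ℕ.< p → + p ∣ powerSum p k
    step k ih k+1<p =
      ℤ∣.∣ᵤ⇒∣ (coprime-divisor (+ p) (+ suc k) (powerSum p k) (prime⇒coprime pr k+1<p) (ℤ∣.∣⇒∣ᵤ p∣top))
      where
      term : Fin (suc k) → ℤ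
      term i = + (suc k C toℕ i) * powerSum p (toℕ i)
      lower : ℤ
      lower = sum (term ∘ inject₁)
      [1+k]Ck≡1+k : suc k C k ≡ suc k
      [1+k]Ck≡1+k = begin
        suc k C k              ≡⟨ nCk≡nC[n∸k] (ℕₚ.n≤1+n k) ⟩
        suc k C (suc k ℕ.∸ k)  ≡⟨ cong (suc k C_) (ℕₚ.m+n∸n≡m 1 k) ⟩
        suc k C 1              ≡⟨ nC1≡n (suc k) ⟩
        suc k                  ∎
      split : lower + + suc k * powerSum p k ≡ (+ p) ^ suc k
      split = begin
        lower + + suc k * powerSum p k
          ≡⟨ cong (λ c → lower + + c * powerSum p k) [1+k]Ck≡1+k ⟨
        lower + + (suc k C k) * powerSum p k
          ≡⟨ cong (λ j → lower + + (suc k C j) * powerSum p j) (Finₚ.toℕ-fromℕ k) ⟨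
        lower + term (fromℕ k)
          ≡⟨ sum-init-last term ⟨
        sum term
          ≡⟨ ∑-binomial-powerSum p k ⟩
        (+ p) ^ suc k ∎
      p∣lower : + p ∣ lower
      p∣lower = ∣-∑ (term ∘ inject₁) λ i →
        let i<k = subst (ℕ._< k) (sym (Finₚ.toℕ-inject₁ i)) (Finₚ.toℕ<n i)
        in ℤ∣.∣n⇒∣m*n (+ (suc k C toℕ (inject₁ i))) (ih i<k (ℕₚ.<-trans (ℕ.s≤s i<k) k+1<p))
      p∣top : + p ∣ + suc k * powerSum p k
      p∣top = ℤ∣.∣m+n∣m⇒∣n (subst (+ p ∣_) (sym split) (ℤ∣.∣m⇒∣m*n ((+ p) ^ k) (ℤ∣.∣-refl {+ p}))) p∣lower

  m-n∣m^k-n^k : ∀ x y k → (x - y) ∣ (x ^ k - y ^ k)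
  m-n∣m^k-n^k x y zero    = divides 0ℤ refl
  m-n∣m^k-n^k x y (suc k) = subst (x - y ∣_) (factor x y (x ^ k) (y ^ k))
    (ℤ∣.∣m∣n⇒∣m+n (ℤ∣.∣n⇒∣m*n x (m-n∣m^k-n^k x y k)) (ℤ∣.∣n⇒∣m*n (y ^ k) ℤ∣.∣-refl))
    where
    factor : ∀ x y xᵏ yᵏ → x * (xᵏ - yᵏ) + yᵏ * (x - y) ≡ x * xᵏ - y * yᵏ
    factor = solve-∀

  injective⇒surjective : ∀ {n} {f : Fin n → Fin n} → Injective _≡_ _≡_ f → Surjective _≡_ _≡_ f
  injective⇒surjective {zero}  inj ()
  injective⇒surjective {suc n} {f} inj y with Finₚ.any? (λ x → f x Finₚ.≟ y)
  ... | yes (x , fx≡y) = x , λ { refl → fx≡y }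
  -- If y is missed, punching it out of the image maps Fin (1 + n) into Fin n, and pigeonhole gives a collision.
  ... | no ∄x with Finₚ.pigeonhole (ℕₚ.n<1+n n) (λ x → punchOut (λ y≡fx → ∄x (x , sym y≡fx)))
  ... | i , j , i<j , fi≡fj = ⊥-elim (Finₚ.<-irrefl (inj fi≡fj′) i<j)
    where
    fi≡fj′ : f i ≡ f j
    fi≡fj′ = Finₚ.punchOut-injective (λ e → ∄x (i , sym e)) (λ e → ∄x (j , sym e)) fi≡fj

  module _ {p : ℕ} (pr : Prime p) where

    private instance
      p≢0 : ℕ.NonZero p
      p≢0 = prime⇒nonZero pr

    residue : ℤ → Fin p
    residue x = Fin.fromℕ< (n%ℕd<d x p)

    p∣x-residue : ∀ x → + p ∣ (x - + toℕ (residue x))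
    p∣x-residue x = divides (x /ℕ p) (begin
      x - + toℕ (residue x)                   ≡⟨ cong (λ r → x - + r) (Finₚ.toℕ-fromℕ< (n%ℕd<d x p)) ⟩
      x - + (x %ℕ p)                          ≡⟨ cong (_- + (x %ℕ p)) (a≡a%ℕn+[a/ℕn]*n x p) ⟩
      + (x %ℕ p) + x /ℕ p * + p - + (x %ℕ p)  ≡⟨ cancel (+ (x %ℕ p)) (x /ℕ p * + p) ⟩
      x /ℕ p * + p                            ∎)
      where
      cancel : ∀ a b → a + b - a ≡ b
      cancel = solve-∀

    residue-injective : ∀ I → CompleteResidues p I → Injective _≡_ _≡_ (residue ∘ I)
    residue-injective I complete {s} {t} eq = complete s t (ℤ∣.∣⇒∣ᵤ (subst (+ p ∣_) (cancel (I s) (I t) r)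
      (ℤ∣.∣m∣n⇒∣m-n (subst (λ j → + p ∣ (I s - + toℕ j)) eq (p∣x-residue (I s))) (p∣x-residue (I t)))))
      where
      r : ℤ
      r = + toℕ (residue (I t))
      cancel : ∀ a b r → (a - r) - (b - r) ≡ a - b
      cancel = solve-∀

    residuePermutation : ∀ I → CompleteResidues p I → Permutation′ p
    residuePermutation I complete = permutation (residue ∘ I) (proj₁ ∘ onto) (λ y → proj₂ (onto y) refl)
      (λ x → residue-injective I complete (proj₂ (onto (residue (I x))) refl))
      where
      onto : Surjective _≡_ _≡_ (residue ∘ I)
      onto = injective⇒surjective (residue-injective I complete)

    p∣∑-pow : ∀ I → CompleteResidues p I → ∀ k → suc k ℕ.< p → + p ∣ ∑[ s < p ] (I s ^ k)
    p∣∑-pow I complete k k+1<p = subst (+ p ∣_) (sym split) (ℤ∣.∣m∣n⇒∣m+n p∣differences p∣residueSum)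
      where
      r : Fin p → ℤ
      r s = + toℕ (residue (I s))
      sub-add : ∀ a b → a - b + b ≡ a
      sub-add = solve-∀
      split : ∑[ s < p ] (I s ^ k) ≡ ∑[ s < p ] (I s ^ k - r s ^ k) + ∑[ s < p ] (r s ^ k)
      split = begin
        ∑[ s < p ] (I s ^ k)                                   ≡⟨ sum-cong-≗ {p} (λ s → sub-add _ _) ⟨
        ∑[ s < p ] (I s ^ k - r s ^ k + r s ^ k)               ≡⟨ ∑-distrib-+ (λ s → I s ^ k - r s ^ k) _ ⟩
        ∑[ s < p ] (I s ^ k - r s ^ k) + ∑[ s < p ] (r s ^ k)  ∎
      p∣differences : + p ∣ ∑[ s < p ] (I s ^ k - r s ^ k)
      p∣differences = ∣-∑ _ λ s → ℤ∣.∣-trans (p∣x-residue (I s)) (m-n∣m^k-n^k (I s) (r s) k)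
      p∣residueSum : + p ∣ ∑[ s < p ] (r s ^ k)
      p∣residueSum = subst (+ p ∣_) (∑-permute (λ j → (+ toℕ j) ^ k) (residuePermutation I complete))
        (p∣powerSum pr k k+1<p)
module Rationals where

  open import Algebra.Bundles using (CommutativeRing)
  import Algebra.Properties.Semiring.Sum
  open import Data.Fin using (Fin; zero; suc; toℕ)
  open import Data.Integer as ℤ using (ℤ; +_)
  import Data.Integer.Properties as ℤₚ
  open import Data.Integer.Tactic.RingSolver using (solve-∀)
  open import Data.Nat as ℕ using (ℕ; zero; suc)
  import Data.Nat.Properties as ℕₚ
  open import Data.Product using (∃; _,_)
  open import Data.Rational as ℚ using (ℚ; mkℚ; _+_; _*_)
  import Data.Rational.Properties as ℚₚ
  open import Data.Rational.Unnormalised as ℚᵘ using (mkℚᵘ; *≡*)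
  import Data.Rational.Unnormalised.Properties as ℚᵘₚ
  open import Data.Vec.Functional using (_∷_)
  open import Function using (_∘_)
  open import Relation.Binary.PropositionalEquality

  module ℤΣ = Algebra.Properties.Semiring.Sum ℤₚ.+-*-semiring
  module ℚΣ = Algebra.Properties.Semiring.Sum (CommutativeRing.semiring ℚₚ.+-*-commutativeRing)

  open ≡-Reasoning

  fromℚᵘ-homo-+ : ∀ x y → ℚ.fromℚᵘ (x ℚᵘ.+ y) ≡ ℚ.fromℚᵘ x + ℚ.fromℚᵘ y
  fromℚᵘ-homo-+ x y = ℚₚ.toℚᵘ-injective (ℚᵘₚ.≃-trans (ℚₚ.toℚᵘ-fromℚᵘ (x ℚᵘ.+ y)) (ℚᵘₚ.≃-sym
    (ℚᵘₚ.≃-trans (ℚₚ.toℚᵘ-homo-+ (ℚ.fromℚᵘ x) (ℚ.fromℚᵘ y))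
                 (ℚᵘₚ.+-cong (ℚₚ.toℚᵘ-fromℚᵘ x) (ℚₚ.toℚᵘ-fromℚᵘ y)))))

  fromℚᵘ-homo-* : ∀ x y → ℚ.fromℚᵘ (x ℚᵘ.* y) ≡ ℚ.fromℚᵘ x * ℚ.fromℚᵘ y
  fromℚᵘ-homo-* x y = ℚₚ.toℚᵘ-injective (ℚᵘₚ.≃-trans (ℚₚ.toℚᵘ-fromℚᵘ (x ℚᵘ.* y)) (ℚᵘₚ.≃-sym
    (ℚᵘₚ.≃-trans (ℚₚ.toℚᵘ-homo-* (ℚ.fromℚᵘ x) (ℚ.fromℚᵘ y))
                 (ℚᵘₚ.*-cong (ℚₚ.toℚᵘ-fromℚᵘ x) (ℚₚ.toℚᵘ-fromℚᵘ y)))))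

  -- ℤ→ℚ z is ℚ.fromℚᵘ (mkℚᵘ z 0) by definition, so it inherits the homomorphism laws of fromℚᵘ.
  ℤ→ℚ-+ : ∀ a b → ℤ→ℚ (a ℤ.+ b) ≡ ℤ→ℚ a + ℤ→ℚ b
  ℤ→ℚ-+ a b = trans (ℚₚ.fromℚᵘ-cong {mkℚᵘ (a ℤ.+ b) 0} {mkℚᵘ a 0 ℚᵘ.+ mkℚᵘ b 0} (*≡* (cross a b)))
                    (fromℚᵘ-homo-+ (mkℚᵘ a 0) (mkℚᵘ b 0))
    where
    cross : ∀ a b → (a ℤ.+ b) ℤ.* (ℤ.1ℤ ℤ.* ℤ.1ℤ) ≡ (a ℤ.* ℤ.1ℤ ℤ.+ b ℤ.* ℤ.1ℤ) ℤ.* ℤ.1ℤ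
    cross = solve-∀

  ℤ→ℚ-* : ∀ a b → ℤ→ℚ (a ℤ.* b) ≡ ℤ→ℚ a * ℤ→ℚ b
  ℤ→ℚ-* a b = trans (ℚₚ.fromℚᵘ-cong {mkℚᵘ (a ℤ.* b) 0} {mkℚᵘ a 0 ℚᵘ.* mkℚᵘ b 0} (*≡* (cross a b)))
                    (fromℚᵘ-homo-* (mkℚᵘ a 0) (mkℚᵘ b 0))
    where
    cross : ∀ a b → (a ℤ.* b) ℤ.* (ℤ.1ℤ ℤ.* ℤ.1ℤ) ≡ (a ℤ.* b) ℤ.* ℤ.1ℤ
    cross = solve-∀

  ℤ→ℚ-pos-* : ∀ m n → ℤ→ℚ (+ (m ℕ.* n)) ≡ ℤ→ℚ (+ m) * ℤ→ℚ (+ n)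
  ℤ→ℚ-pos-* m n = trans (cong ℤ→ℚ (ℤₚ.pos-* m n)) (ℤ→ℚ-* (+ m) (+ n))

  ℤ→ℚ-injective : ∀ {a b} → ℤ→ℚ a ≡ ℤ→ℚ b → a ≡ b
  ℤ→ℚ-injective {a} {b} eq with ℚₚ.fromℚᵘ-injective {mkℚᵘ a 0} {mkℚᵘ b 0} eq
  ... | *≡* a*1≡b*1 = trans (sym (ℤₚ.*-identityʳ a)) (trans a*1≡b*1 (ℤₚ.*-identityʳ b))

  ℤ→ℚ-^ : ∀ z k → ℤ→ℚ z ^ℚ k ≡ ℤ→ℚ (z ℤ.^ k)
  ℤ→ℚ-^ z zero    = refl
  ℤ→ℚ-^ z (suc k) = trans (cong (ℤ→ℚ z *_) (ℤ→ℚ-^ z k)) (sym (ℤ→ℚ-* z (z ℤ.^ k)))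

  ℤ→ℚ-∑ : ∀ m (g : Fin m → ℤ) → sumFin m (ℤ→ℚ ∘ g) ≡ ℤ→ℚ (ℤΣ.sum g)
  ℤ→ℚ-∑ zero    g = refl
  ℤ→ℚ-∑ (suc m) g = trans (cong (λ x → ℤ→ℚ (g zero) + x) (ℤ→ℚ-∑ m (g ∘ suc)))
                          (sym (ℤ→ℚ-+ (g zero) (ℤΣ.sum (g ∘ suc))))

  *-denominator≡numerator : ∀ c → c * ℤ→ℚ (+ ℚ.denominatorℕ c) ≡ ℤ→ℚ (ℚ.numerator c)
  *-denominator≡numerator c@(mkℚ n d-1 _) = begin
    c * ℤ→ℚ (+ suc d-1)                             ≡⟨ cong (_* ℤ→ℚ (+ suc d-1)) (ℚₚ.fromℚᵘ-toℚᵘ c) ⟨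
    ℚ.fromℚᵘ (mkℚᵘ n d-1) * ℤ→ℚ (+ suc d-1)         ≡⟨ fromℚᵘ-homo-* (mkℚᵘ n d-1) (mkℚᵘ (+ suc d-1) 0) ⟨
    ℚ.fromℚᵘ (mkℚᵘ n d-1 ℚᵘ.* mkℚᵘ (+ suc d-1) 0)  ≡⟨ ℚₚ.fromℚᵘ-cong {product} {mkℚᵘ n 0} (*≡* cross) ⟩
    ℤ→ℚ n                                           ∎
    where
    product : ℚᵘ.ℚᵘ
    product = mkℚᵘ n d-1 ℚᵘ.* mkℚᵘ (+ suc d-1) 0
    cross : n ℤ.* + suc d-1 ℤ.* ℤ.1ℤ ≡ n ℤ.* + (suc d-1 ℕ.* 1)
    cross = trans (ℤₚ.*-identityʳ _) (cong (λ k → n ℤ.* + suc k) (sym (ℕₚ.*-identityʳ d-1)))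

  sumFin≡∑ : ∀ m (g : Fin m → ℚ) → sumFin m g ≡ ℚΣ.sum g
  sumFin≡∑ zero    g = refl
  sumFin≡∑ (suc m) g = cong (λ x → g zero + x) (sumFin≡∑ m (g ∘ suc))

  sumFin-cong : ∀ m {g h : Fin m → ℚ} → (∀ i → g i ≡ h i) → sumFin m g ≡ sumFin m h
  sumFin-cong zero    g≗h = refl
  sumFin-cong (suc m) g≗h = cong₂ _+_ (g≗h zero) (sumFin-cong m (g≗h ∘ suc))

  sumFin-*ˡ : ∀ m c (g : Fin m → ℚ) → sumFin m (λ i → c * g i) ≡ c * sumFin m g
  sumFin-*ˡ m c g = begin
    sumFin m (λ i → c * g i)  ≡⟨ sumFin≡∑ m _ ⟩
    ℚΣ.sum (λ i → c * g i)    ≡⟨ ℚΣ.*-distribˡ-sum c g ⟨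
    c * ℚΣ.sum g              ≡⟨ cong (c *_) (sumFin≡∑ m g) ⟨
    c * sumFin m g            ∎

  sumFin-*ʳ : ∀ m c (g : Fin m → ℚ) → sumFin m (λ i → g i * c) ≡ sumFin m g * c
  sumFin-*ʳ m c g = begin
    sumFin m (λ i → g i * c)  ≡⟨ sumFin≡∑ m _ ⟩
    ℚΣ.sum (λ i → g i * c)    ≡⟨ ℚΣ.*-distribʳ-sum c g ⟨
    ℚΣ.sum g * c              ≡⟨ cong (_* c) (sumFin≡∑ m g) ⟨
    sumFin m g * c            ∎

  sumFin-comm : ∀ k m (G : Fin k → Fin m → ℚ) →
    sumFin k (λ i → sumFin m (G i)) ≡ sumFin m (λ j → sumFin k (λ i → G i j))
  sumFin-comm k m G = begin
    sumFin k (λ i → sumFin m (G i))          ≡⟨ sumFin≡∑ k _ ⟩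
    ℚΣ.sum (λ i → sumFin m (G i))            ≡⟨ ℚΣ.sum-cong-≗ {k} (λ i → sumFin≡∑ m (G i)) ⟩
    ℚΣ.sum (λ i → ℚΣ.sum (G i))              ≡⟨ ℚΣ.∑-comm G ⟩
    ℚΣ.sum (λ j → ℚΣ.sum (λ i → G i j))      ≡⟨ ℚΣ.sum-cong-≗ {m} (λ j → sumFin≡∑ k (λ i → G i j)) ⟨
    ℚΣ.sum (λ j → sumFin k (λ i → G i j))    ≡⟨ sumFin≡∑ m _ ⟨
    sumFin m (λ j → sumFin k (λ i → G i j))  ∎

  sumTuples-cong : ∀ n m {g h : (Fin n → Fin m) → ℚ} → (∀ t → g t ≡ h t) → sumTuples n m g ≡ sumTuples n m h
  sumTuples-cong zero    m g≗h = g≗h _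
  sumTuples-cong (suc n) m g≗h = sumFin-cong m (λ i → sumTuples-cong n m (λ t → g≗h (i ∷ t)))

  sumTuples-*ˡ : ∀ n m c (g : (Fin n → Fin m) → ℚ) → sumTuples n m (λ t → c * g t) ≡ c * sumTuples n m g
  sumTuples-*ˡ zero    m c g = refl
  sumTuples-*ˡ (suc n) m c g =
    trans (sumFin-cong m (λ i → sumTuples-*ˡ n m c (λ t → g (i ∷ t)))) (sumFin-*ˡ m c _)

  sumFin-sumTuples-comm : ∀ k n m (G : Fin k → (Fin n → Fin m) → ℚ) →
    sumFin k (λ i → sumTuples n m (G i)) ≡ sumTuples n m (λ t → sumFin k (λ i → G i t))
  sumFin-sumTuples-comm k zero    m G = refl
  sumFin-sumTuples-comm k (suc n) m G = trans (sumFin-comm k m _)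
    (sumFin-cong m (λ j → sumFin-sumTuples-comm k n m (λ i t → G i (j ∷ t))))

  sumTuples-comm : ∀ n m n′ m′ (G : (Fin n → Fin m) → (Fin n′ → Fin m′) → ℚ) →
    sumTuples n m (λ t → sumTuples n′ m′ (G t)) ≡ sumTuples n′ m′ (λ e → sumTuples n m (λ t → G t e))
  sumTuples-comm zero    m n′ m′ G = refl
  sumTuples-comm (suc n) m n′ m′ G =
    trans (sumFin-cong m (λ i → sumTuples-comm n m n′ m′ (λ t → G (i ∷ t)))) (sumFin-sumTuples-comm m n′ m′ _)

  sumTuples-prodFin : ∀ n m (g : Fin n → Fin m → ℚ) →
    sumTuples n m (λ t → prodFin n (λ j → g j (t j))) ≡ prodFin n (λ j → sumFin m (g j))
  sumTuples-prodFin zero    m g = refl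
  sumTuples-prodFin (suc n) m g = begin
    sumFin m (λ i → sumTuples n m (λ t → g zero i * prodFin n (λ j → g (suc j) (t j))))
      ≡⟨ sumFin-cong m (λ i → sumTuples-*ˡ n m (g zero i) _) ⟩
    sumFin m (λ i → g zero i * sumTuples n m (λ t → prodFin n (λ j → g (suc j) (t j))))
      ≡⟨ sumFin-cong m (λ i → cong (g zero i *_) (sumTuples-prodFin n m (g ∘ suc))) ⟩
    sumFin m (λ i → g zero i * prodFin n (λ j → sumFin m (g (suc j))))
      ≡⟨ sumFin-*ʳ m _ (g zero) ⟩
    sumFin m (g zero) * prodFin n (λ j → sumFin m (g (suc j))) ∎

  sumTuples-eval : ∀ {n} m (f : Poly n) (a : Fin n → Fin m → ℤ) →
    sumTuples n m (λ t → eval f (λ j → a j (t j))) ≡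
    sumTuples n (suc (D f)) (λ e → coef f e * prodFin n (λ j → sumFin m (λ s → ℤ→ℚ (a j s) ^ℚ toℕ (e j))))
  sumTuples-eval {n} m f a = trans (sumTuples-comm n m n (suc (D f)) _) (sumTuples-cong n (suc (D f)) λ e →
    trans (sumTuples-*ˡ n m (coef f e) _)
          (cong (coef f e *_) (sumTuples-prodFin n m (λ j s → ℤ→ℚ (a j s) ^ℚ toℕ (e j)))))

  sumFin-integral : ∀ m (g : Fin m → ℚ) → (∀ i → ∃ λ z → g i ≡ ℤ→ℚ z) → ∃ λ z → sumFin m g ≡ ℤ→ℚ z
  sumFin-integral zero    g integral = + 0 , refl
  sumFin-integral (suc m) g integral with integral zero | sumFin-integral m (g ∘ suc) (integral ∘ suc)
  ... | z , g₀≡z | w , rest≡w = z ℤ.+ w , trans (cong₂ _+_ g₀≡z rest≡w) (sym (ℤ→ℚ-+ z w))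

  sumTuples-integral : ∀ n m (g : (Fin n → Fin m) → ℚ) →
    (∀ t → ∃ λ z → g t ≡ ℤ→ℚ z) → ∃ λ z → sumTuples n m g ≡ ℤ→ℚ z
  sumTuples-integral zero    m g integral = integral _
  sumTuples-integral (suc n) m g integral =
    sumFin-integral m _ (λ i → sumTuples-integral n m _ (λ t → integral (i ∷ t)))


module PAdicValuation where

  open Rationals using (ℤ→ℚ-+; ℤ→ℚ-*; ℤ→ℚ-pos-*; ℤ→ℚ-injective; *-denominator≡numerator)
  open import Data.Fin using (Fin; zero; suc)
  open import Data.Integer as ℤ using (ℤ; +_)
  import Data.Integer.Properties as ℤₚ
  open import Data.Integer.Divisibility.Signed as ℤ∣ using (divides)
  open import Data.Integer.Tactic.RingSolver using (solve-∀)
  open import Data.Nat as ℕ using (ℕ; zero; suc; _^_)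
  open import Data.Nat.Divisibility as ℕ∣ using (_∣_; _∤_)
  open import Data.Nat.Primality using (Prime; euclidsLemma; prime⇒nonZero; prime⇒nonTrivial)
  import Data.Nat.Properties as ℕₚ
  import Data.Nat.Tactic.RingSolver as ℕSolver
  open import Data.Rational as ℚ using (ℚ; 0ℚ; _+_; _*_)
  import Data.Rational.Properties as ℚₚ
  open import Data.Rational.Solver using (module +-*-Solver)
  open import Data.Sum using (inj₁; inj₂)
  open import Function using (_∘_)
  open import Relation.Binary.PropositionalEquality
  open import Relation.Nullary using (contradiction)

  module _ {p : ℕ} (pr : Prime p) where

    private instance
      p≢0 : ℕ.NonZero p
      p≢0 = prime⇒nonZero pr

    p∤1 : p ∤ 1
    p∤1 p∣1 = ℕₚ.<⇒≢ (ℕ.nonTrivial⇒n>1 p {{prime⇒nonTrivial pr}}) (sym (ℕ∣.∣1⇒≡1 p∣1))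

    p∤* : ∀ {a b} → p ∤ a → p ∤ b → p ∤ a ℕ.* b
    p∤* {a} {b} p∤a p∤b p∣ab with euclidsLemma a b pr p∣ab
    ... | inj₁ p∣a = p∤a p∣a
    ... | inj₂ p∣b = p∤b p∣b

    p^m∣n*b⇒p^m∣n : ∀ m {n b} → p ∤ b → p ^ m ∣ n ℕ.* b → p ^ m ∣ n
    p^m∣n*b⇒p^m∣n zero    {n}     p∤b _ = ℕ∣.1∣ n
    p^m∣n*b⇒p^m∣n (suc m) {n} {b} p∤b p^[1+m]∣nb
      with euclidsLemma n b pr (ℕ∣.∣-trans (ℕ∣.m∣m*n (p ^ m)) p^[1+m]∣nb)
    ... | inj₂ p∣b = contradiction p∣b p∤b
    ... | inj₁ (ℕ∣.divides w refl) = subst (p ^ suc m ∣_) (ℕₚ.*-comm p w) (ℕ∣.*-monoʳ-∣ p p^m∣w)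
      where
      reassoc : ∀ w p b → w ℕ.* p ℕ.* b ≡ p ℕ.* (w ℕ.* b)
      reassoc = ℕSolver.solve-∀
      p^m∣w : p ^ m ∣ w
      p^m∣w = p^m∣n*b⇒p^m∣n m p∤b (ℕ∣.*-cancelˡ-∣ p (subst (p ^ suc m ∣_) (reassoc w p b) p^[1+m]∣nb))

    record ValuationAtLeast (m : ℕ) (q : ℚ) : Set where
      constructor witness
      field
        numerator                   : ℤ
        denominator                 : ℕ
        p∤denominator               : p ∤ denominator
        q*denominator≡numerator*pᵐ  : q * ℤ→ℚ (+ denominator) ≡ ℤ→ℚ (numerator ℤ.* + p ^ m)

    valuation-0ℚ : ∀ m → ValuationAtLeast m 0ℚ
    valuation-0ℚ m =
      witness (+ 0) 1 p∤1 (trans (ℚₚ.*-zeroˡ (ℤ→ℚ (+ 1))) (cong ℤ→ℚ (sym (ℤₚ.*-zeroˡ (+ p ^ m)))))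

    valuation-+ : ∀ {m x y} → ValuationAtLeast m x → ValuationAtLeast m y → ValuationAtLeast m (x + y)
    valuation-+ {m} {x} {y} (witness a₁ b₁ p∤b₁ x≡) (witness a₂ b₂ p∤b₂ y≡) =
      witness (a₁ ℤ.* + b₂ ℤ.+ a₂ ℤ.* + b₁) (b₁ ℕ.* b₂) (p∤* p∤b₁ p∤b₂) (begin
        (x + y) * ℤ→ℚ (+ (b₁ ℕ.* b₂))
          ≡⟨ cong ((x + y) *_) (ℤ→ℚ-pos-* b₁ b₂) ⟩
        (x + y) * (B₁ * B₂)
          ≡⟨ expand x y B₁ B₂ ⟩
        (x * B₁) * B₂ + (y * B₂) * B₁
          ≡⟨ cong₂ (λ u v → u * B₂ + v * B₁) x≡ y≡ ⟩
        ℤ→ℚ (a₁ ℤ.* pᵐ) * B₂ + ℤ→ℚ (a₂ ℤ.* pᵐ) * B₁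
          ≡⟨ cong₂ _+_ (ℤ→ℚ-* (a₁ ℤ.* pᵐ) (+ b₂)) (ℤ→ℚ-* (a₂ ℤ.* pᵐ) (+ b₁)) ⟨
        ℤ→ℚ (a₁ ℤ.* pᵐ ℤ.* + b₂) + ℤ→ℚ (a₂ ℤ.* pᵐ ℤ.* + b₁)
          ≡⟨ ℤ→ℚ-+ (a₁ ℤ.* pᵐ ℤ.* + b₂) (a₂ ℤ.* pᵐ ℤ.* + b₁) ⟨
        ℤ→ℚ (a₁ ℤ.* pᵐ ℤ.* + b₂ ℤ.+ a₂ ℤ.* pᵐ ℤ.* + b₁)
          ≡⟨ cong ℤ→ℚ (collect a₁ a₂ pᵐ (+ b₁) (+ b₂)) ⟩
        ℤ→ℚ ((a₁ ℤ.* + b₂ ℤ.+ a₂ ℤ.* + b₁) ℤ.* pᵐ) ∎)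
      where
      open ≡-Reasoning
      open +-*-Solver
      pᵐ : ℤ
      pᵐ = + p ^ m
      B₁ B₂ : ℚ
      B₁ = ℤ→ℚ (+ b₁)
      B₂ = ℤ→ℚ (+ b₂)
      expand : ∀ x y u v → (x + y) * (u * v) ≡ (x * u) * v + (y * v) * u
      expand = solve 4 (λ x y u v → (x :+ y) :* (u :* v) := (x :* u) :* v :+ (y :* v) :* u) refl
      collect : ∀ a₁ a₂ q b₁ b₂ → a₁ ℤ.* q ℤ.* b₂ ℤ.+ a₂ ℤ.* q ℤ.* b₁ ≡ (a₁ ℤ.* b₂ ℤ.+ a₂ ℤ.* b₁) ℤ.* q
      collect = solve-∀

    valuation-* : ∀ {m m′ x y} →
      ValuationAtLeast m x → ValuationAtLeast m′ y → ValuationAtLeast (m ℕ.+ m′) (x * y)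
    valuation-* {m} {m′} {x} {y} (witness a₁ b₁ p∤b₁ x≡) (witness a₂ b₂ p∤b₂ y≡) =
      witness (a₁ ℤ.* a₂) (b₁ ℕ.* b₂) (p∤* p∤b₁ p∤b₂) (begin
        (x * y) * ℤ→ℚ (+ (b₁ ℕ.* b₂))          ≡⟨ cong ((x * y) *_) (ℤ→ℚ-pos-* b₁ b₂) ⟩
        (x * y) * (B₁ * B₂)                    ≡⟨ regroup x y B₁ B₂ ⟩
        (x * B₁) * (y * B₂)                    ≡⟨ cong₂ _*_ x≡ y≡ ⟩
        ℤ→ℚ (a₁ ℤ.* pᵐ) * ℤ→ℚ (a₂ ℤ.* pᵐ′)     ≡⟨ ℤ→ℚ-* (a₁ ℤ.* pᵐ) (a₂ ℤ.* pᵐ′) ⟨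
        ℤ→ℚ (a₁ ℤ.* pᵐ ℤ.* (a₂ ℤ.* pᵐ′))       ≡⟨ cong ℤ→ℚ (regroupℤ a₁ a₂ pᵐ pᵐ′) ⟩
        ℤ→ℚ (a₁ ℤ.* a₂ ℤ.* (pᵐ ℤ.* pᵐ′))       ≡⟨ cong (λ z → ℤ→ℚ (a₁ ℤ.* a₂ ℤ.* z)) p^[m+m′] ⟨
        ℤ→ℚ (a₁ ℤ.* a₂ ℤ.* + p ^ (m ℕ.+ m′))   ∎)
      where
      open ≡-Reasoning
      open +-*-Solver
      pᵐ pᵐ′ : ℤ
      pᵐ = + p ^ m
      pᵐ′ = + p ^ m′
      B₁ B₂ : ℚ
      B₁ = ℤ→ℚ (+ b₁)
      B₂ = ℤ→ℚ (+ b₂)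
      p^[m+m′] : + p ^ (m ℕ.+ m′) ≡ pᵐ ℤ.* pᵐ′
      p^[m+m′] = trans (cong +_ (ℕₚ.^-distribˡ-+-* p m m′)) (ℤₚ.pos-* (p ^ m) (p ^ m′))
      regroup : ∀ x y u v → (x * y) * (u * v) ≡ (x * u) * (y * v)
      regroup = solve 4 (λ x y u v → (x :* y) :* (u :* v) := (x :* u) :* (y :* v)) refl
      regroupℤ : ∀ a₁ a₂ q q′ → a₁ ℤ.* q ℤ.* (a₂ ℤ.* q′) ≡ a₁ ℤ.* a₂ ℤ.* (q ℤ.* q′)
      regroupℤ = solve-∀

    valuation-sumFin : ∀ m k (g : Fin k → ℚ) →
      (∀ i → ValuationAtLeast m (g i)) → ValuationAtLeast m (sumFin k g)
    valuation-sumFin m zero    g v = valuation-0ℚ m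
    valuation-sumFin m (suc k) g v = valuation-+ (v zero) (valuation-sumFin m k (g ∘ suc) (v ∘ suc))

    valuation-sumTuples : ∀ m n k (g : (Fin n → Fin k) → ℚ) →
      (∀ t → ValuationAtLeast m (g t)) → ValuationAtLeast m (sumTuples n k g)
    valuation-sumTuples m zero    k g v = v _
    valuation-sumTuples m (suc n) k g v = valuation-sumFin m k _ (λ i → valuation-sumTuples m n k _ (λ t → v _))

    valuation-prodFin : ∀ m n (g : Fin n → ℚ) →
      (∀ j → ValuationAtLeast m (g j)) → ValuationAtLeast (n ℕ.* m) (prodFin n g)
    valuation-prodFin m zero    g v = witness (+ 1) 1 p∤1 refl
    valuation-prodFin m (suc n) g v = valuation-* (v zero) (valuation-prodFin m n (g ∘ suc) (v ∘ suc))

    valuation-ℤ : ∀ m z → + (p ^ m) ℤ∣.∣ z → ValuationAtLeast m (ℤ→ℚ z)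
    valuation-ℤ m z (divides q z≡q*pᵐ) = witness q 1 p∤1 (trans (ℚₚ.*-identityʳ _) (cong ℤ→ℚ z≡q*pᵐ))

    valuation-vpNonneg : ∀ c → vpNonneg p c → ValuationAtLeast 0 c
    valuation-vpNonneg c p∤d = witness (ℚ.numerator c) (ℚ.denominatorℕ c) p∤d
      (trans (*-denominator≡numerator c) (cong ℤ→ℚ (sym (ℤₚ.*-identityʳ (ℚ.numerator c)))))

    valuation-ℤ⇒∣ : ∀ m z → ValuationAtLeast m (ℤ→ℚ z) → + (p ^ m) ℤ∣.∣ z
    valuation-ℤ⇒∣ m z (witness a b p∤b z*b≡a*pᵐ) = ℤ∣.∣ᵤ⇒∣ (p^m∣n*b⇒p^m∣n m p∤b (ℕ∣.divides ℤ.∣ a ∣ (begin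
      ℤ.∣ z ∣ ℕ.* b        ≡⟨ ℤₚ.abs-* z (+ b) ⟨
      ℤ.∣ z ℤ.* + b ∣      ≡⟨ cong ℤ.∣_∣ z*b≡a*pᵐ′ ⟩
      ℤ.∣ a ℤ.* + p ^ m ∣  ≡⟨ ℤₚ.abs-* a (+ p ^ m) ⟩
      ℤ.∣ a ∣ ℕ.* p ^ m    ∎)))
      where
      open ≡-Reasoning
      z*b≡a*pᵐ′ : z ℤ.* + b ≡ a ℤ.* + p ^ m
      z*b≡a*pᵐ′ = ℤ→ℚ-injective (trans (ℤ→ℚ-* z (+ b)) z*b≡a*pᵐ)


open IntegerPowerSums using (p∣∑-pow)
open Rationals using (ℤ→ℚ-^; ℤ→ℚ-∑; sumFin-cong; sumTuples-integral; sumTuples-eval)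
open PAdicValuation
import Algebra.Properties.Semiring.Sum
open import Data.Fin using (Fin; toℕ)
open import Data.Integer using (ℤ; +_; _*_)
import Data.Integer as ℤ
import Data.Integer.Divisibility.Signed as ℤ∣
import Data.Integer.Properties as ℤₚ
open import Data.Nat using (ℕ; suc; _≤_; _<_; _+_; _∸_; _^_; nonTrivial⇒n>1)
open import Data.Nat.Primality using (Prime; prime⇒nonTrivial)
import Data.Nat.Properties as ℕₚ
open import Data.Product using (∃; Σ; _,_)
open import Data.Rational using (ℚ; 0ℚ)
import Data.Rational as ℚ
import Data.Rational.Properties as ℚₚ
open import Relation.Binary.PropositionalEquality using (_≡_; sym; trans; cong; subst)
open import Relation.Nullary using (¬_; yes; no)

open Algebra.Properties.Semiring.Sum ℤₚ.+-*-semiring using (sum)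

≤∸2⇒< : ∀ {k p} → 2 ≤ p → k ≤ p ∸ 2 → suc k < p
≤∸2⇒< {k} 2≤p k≤p∸2 = subst (2 + k ≤_) (ℕₚ.m+[n∸m]≡n 2≤p) (ℕₚ.+-monoʳ-≤ 2 k≤p∸2)

module _ {p : ℕ} (pr : Prime p) where

  p≥2 : 2 ≤ p
  p≥2 = nonTrivial⇒n>1 p {{prime⇒nonTrivial pr}}

  sumFin-pow-valuation : ∀ (I : Fin p → ℤ) → CompleteResidues p I → ∀ k → suc k < p →
    ValuationAtLeast pr 1 (sumFin p (λ s → ℤ→ℚ (I s) ^ℚ k))
  sumFin-pow-valuation I complete k k+1<p =
    subst (ValuationAtLeast pr 1) (sym embed) (valuation-ℤ pr 1 powSum p∣powSum)
    where
    powSum : ℤ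
    powSum = sum (λ s → I s ℤ.^ k)
    embed : sumFin p (λ s → ℤ→ℚ (I s) ^ℚ k) ≡ ℤ→ℚ powSum
    embed = trans (sumFin-cong p (λ s → ℤ→ℚ-^ (I s) k)) (ℤ→ℚ-∑ p (λ s → I s ℤ.^ k))
    p∣powSum : + (p ^ 1) ℤ∣.∣ powSum
    p∣powSum = subst (λ q → + q ℤ∣.∣ powSum) (sym (ℕₚ.*-identityʳ p)) (p∣∑-pow pr I complete k k+1<p)

  boxSum-valuation : ∀ {n} (I : Fin n → Fin p → ℤ) → (∀ j → CompleteResidues p (I j)) →
    (f : Poly n) → (∀ j → degLe f j (p ∸ 2)) → (∀ e → ¬ (coef f e ≡ 0ℚ) → vpNonneg p (coef f e)) →
    ValuationAtLeast pr n (sumTuples n p (λ t → eval f (λ j → I j (t j))))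
  boxSum-valuation {n} I complete f deg p-integral =
    subst (ValuationAtLeast pr n) (sym (sumTuples-eval p f I))
      (valuation-sumTuples pr n n _ _ monomialSum-valuation)
    where
    powerSums : (Fin n → Fin (suc (D f))) → ℚ
    powerSums e = prodFin n (λ j → sumFin p (λ s → ℤ→ℚ (I j s) ^ℚ toℕ (e j)))
    monomialSum-valuation : ∀ e → ValuationAtLeast pr n (coef f e ℚ.* powerSums e)
    monomialSum-valuation e with coef f e ℚₚ.≟ 0ℚ
    ... | yes c≡0 = subst (ValuationAtLeast pr n)
      (sym (trans (cong (ℚ._* powerSums e) c≡0) (ℚₚ.*-zeroˡ (powerSums e)))) (valuation-0ℚ pr n)
    ... | no c≢0 = valuation-* pr (valuation-vpNonneg pr (coef f e) (p-integral e c≢0))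
      (subst (λ m → ValuationAtLeast pr m (powerSums e)) (ℕₚ.*-identityʳ n) (valuation-prodFin pr 1 n _ λ j →
        sumFin-pow-valuation (I j) (complete j) (toℕ (e j)) (≤∸2⇒< p≥2 (deg j e c≢0))))

lemma2p6 : (p n : ℕ) → Prime p → 1 ≤ n →
    (I : Fin n → Fin p → ℤ) → (∀ j → CompleteResidues p (I j)) →
    (f : Poly n) → IntegerValued f →
    (∀ j → degLe f j (p ∸ 2)) →
    (∀ e → ¬ (coef f e ≡ 0ℚ) → vpNonneg p (coef f e)) →
    ∃ λ (k : ℤ) → sumTuples n p (λ t → eval f (λ j → I j (t j))) ≡ ℤ→ℚ (k * (+ (p ^ n)))
lemma2p6 p n pr _ I complete f integerValued deg p-integral = k , trans S≡z (cong ℤ→ℚ z≡k*pⁿ)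
  where
  open Σ (sumTuples-integral n p _ (λ t → integerValued (λ j → I j (t j)))) renaming (proj₁ to z; proj₂ to S≡z)
  open ℤ∣._∣_ (valuation-ℤ⇒∣ pr n z (subst (ValuationAtLeast pr n) S≡z
                 (boxSum-valuation pr I complete f deg p-integral)))
    renaming (quotient to k; equality to z≡k*pⁿ)
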